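{- For every formula $A$ of the system $\mathsf P$, there is a derivation in $\mathsf P$ from $\mathtt T$ to $A\vee\overline A$.
   Context: The system $\mathsf P$. Formulas: $A,B::=\mathtt T\mid\mathtt F\mid x\mid\overline x\mid A\wedge B\mid A\,\pi_0\,B\mid A\,\pi_1\,B\mid A\vee B$, where $x$ ranges over a set $\mathcal V_{\mathsf P}$ of variables and $\pi_0,\pi_1$ are binary relation symbols (projections on the first, resp. second, argument). Negation is the involution $\overline{\mathtt T}=\mathtt F$, $\overline{\mathtt F}=\mathtt T$, $\overline{\overline x}=x$, $\overline{A\vee B}=\overline A\wedge\overline B$, $\overline{A\wedge B}=\overline A\vee\overline B$, $\overline{A\,\pi_i\,B}=\overline A\,\pi_i\,\overline B$ ($i\in\{0,1\}$). The relations are ordered by $\wedge\prec\pi_0,\pi_1\prec\vee$. The congruence $=_{\mathsf P}$ is generated by: associativity of $\wedge,\vee,\pi_0,\pi_1$; commutativity of $\wedge,\vee$; $A\vee\mathtt F=A$; $A\,\pi_0\,B=A$; $A\,\pi_1\,B=B$; $u\wedge\mathtt F=\mathtt F$ for $u\in\{\mathtt F,\mathtt T\}$; $u\vee\overline u=\mathtt T$ for $u\in\{\mathtt F,\mathtt T\}$; $x\vee\overline x=\mathtt T$ for every variable $x$; $u\vee u=u$ for $u\in\{\mathtt F,\mathtt T\}$; $x\vee x=x$ for every variable $x$; together with the negated versions $\overline E=\overline F$ of all these axioms $E=F$ (all formulas $A,B$ arbitrary). The rules of $\mathsf P$ (premise $\Rightarrow$ conclusion, $j\in\{0,1\}$,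 $A,B,C,D$ arbitrary formulas) are: $ai_j{\downarrow}$: $(A\vee B)\pi_j(C\vee D)\Rightarrow(A\pi_jC)\vee(B\pi_jD)$; $ai_j{\uparrow}$: $(A\pi_jC)\wedge(B\pi_jD)\Rightarrow(A\wedge B)\pi_j(C\wedge D)$; $s{\downarrow}$: $(A\vee B)\wedge(C\vee D)\Rightarrow(A\wedge C)\vee(B\vee D)$; $s{\uparrow}$: $(A\vee C)\wedge(B\wedge D)\Rightarrow(A\wedge B)\vee(C\wedge D)$; $m{\downarrow}$: $(A\wedge B)\vee(C\wedge D)\Rightarrow(A\vee C)\wedge(B\vee D)$; $m{\uparrow}$: $(A\wedge C)\vee(B\wedge D)\Rightarrow(A\vee B)\wedge(C\vee D)$; $c_j{\downarrow}$: $(A\pi_jB)\vee(C\pi_jD)\Rightarrow(A\vee C)\pi_j(B\vee D)$; $c_j{\uparrow}$: $(A\wedge C)\pi_j(B\wedge D)\Rightarrow(A\pi_jB)\wedge(C\pi_jD)$. A derivation from $A$ to $B$ is a finite sequence of formulas from $A$ to $B$ in which each step replaces, inside some context (a formula with a hole), the premise of a rule instance by its conclusion, formulas being taken modulo $=_{\mathsf P}$. -}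

module Defs where

-- index of the projection relation symbols pi_0, pi_1
data J : Set where
  j0 j1 : J

module _ (V : Set) where

  infixr 6 _∧_
  infixr 5 _∨_

  data Formula : Set where
    T F   : Formula
    var   : V → Formula
    nvar  : V → Formula
    _∧_   : Formula → Formula → Formula
    _π[_]_ : Formula → J → Formula → Formula
    _∨_   : Formula → Formula → Formula

  neg : Formula → Formula
  neg T = F
  neg F = T
  neg (var x) = nvar x
  neg (nvar x) = var x
  neg (A ∧ B) = neg A ∨ neg B
  neg (A π[ j ] B) = neg A π[ j ] neg B
  neg (A ∨ B) = neg A ∧ neg B

  data Ax : Formula → Formula → Set where
    ∧-assoc : ∀ A B C → Ax ((A ∧ B) ∧ C) (A ∧ (B ∧ C))
    ∨-assoc : ∀ A B C → Ax ((A ∨ B) ∨ C) (A ∨ (B ∨ C))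
    π-assoc : ∀ j A B C → Ax ((A π[ j ] B) π[ j ] C) (A π[ j ] (B π[ j ] C))
    ∧-comm  : ∀ A B → Ax (A ∧ B) (B ∧ A)
    ∨-comm  : ∀ A B → Ax (A ∨ B) (B ∨ A)
    ∨-unit  : ∀ A → Ax (A ∨ F) A
    π0-proj : ∀ A B → Ax (A π[ j0 ] B) A
    π1-proj : ∀ A B → Ax (A π[ j1 ] B) B
    FF∧     : Ax (F ∧ F) F
    TF∧     : Ax (T ∧ F) F
    F∨T     : Ax (F ∨ neg F) T
    T∨F     : Ax (T ∨ neg T) T
    x∨x̄     : ∀ x → Ax (var x ∨ nvar x) T
    F∨F     : Ax (F ∨ F) F
    T∨T     : Ax (T ∨ T) T
    x∨x     : ∀ x → Ax (var x ∨ var x) (var x)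

  infix 4 _≈P_
  data _≈P_ : Formula → Formula → Set where
    ax     : ∀ {A B} → Ax A B → A ≈P B
    nax    : ∀ {A B} → Ax A B → neg A ≈P neg B
    refl   : ∀ {A} → A ≈P A
    sym    : ∀ {A B} → A ≈P B → B ≈P A
    trans  : ∀ {A B C} → A ≈P B → B ≈P C → A ≈P C
    ∧-cong : ∀ {A A′ B B′} → A ≈P A′ → B ≈P B′ → A ∧ B ≈P A′ ∧ B′
    ∨-cong : ∀ {A A′ B B′} → A ≈P A′ → B ≈P B′ → A ∨ B ≈P A′ ∨ B′
    π-cong : ∀ {j A A′ B B′} → A ≈P A′ → B ≈P B′ → A π[ j ] B ≈P A′ π[ j ] B′

  -- rule instances: premise ⇒ conclusion
  data Rule : Formula → Formula → Set where
    ai↓ : ∀ j A B C D → Rule ((A ∨ B) π[ j ] (C ∨ D)) ((A π[ j ] C) ∨ (B π[ j ] D))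
    ai↑ : ∀ j A B C D → Rule ((A π[ j ] C) ∧ (B π[ j ] D)) ((A ∧ B) π[ j ] (C ∧ D))
    s↓  : ∀ A B C D → Rule ((A ∨ B) ∧ (C ∨ D)) ((A ∧ C) ∨ (B ∨ D))
    s↑  : ∀ A B C D → Rule ((A ∨ C) ∧ (B ∧ D)) ((A ∧ B) ∨ (C ∧ D))
    m↓  : ∀ A B C D → Rule ((A ∧ B) ∨ (C ∧ D)) ((A ∨ C) ∧ (B ∨ D))
    m↑  : ∀ A B C D → Rule ((A ∧ C) ∨ (B ∧ D)) ((A ∨ B) ∧ (C ∨ D))
    c↓  : ∀ j A B C D → Rule ((A π[ j ] B) ∨ (C π[ j ] D)) ((A ∨ C) π[ j ] (B ∨ D))
    c↑  : ∀ j A B C D → Rule ((A ∧ C) π[ j ] (B ∧ D)) ((A π[ j ] B) ∧ (C π[ j ] D))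

  data Ctx : Set where
    hole : Ctx
    _∧ₗ_ : Ctx → Formula → Ctx
    _∧ᵣ_ : Formula → Ctx → Ctx
    _∨ₗ_ : Ctx → Formula → Ctx
    _∨ᵣ_ : Formula → Ctx → Ctx
    πₗ   : J → Ctx → Formula → Ctx
    πᵣ   : J → Formula → Ctx → Ctx

  plug : Ctx → Formula → Formula
  plug hole X = X
  plug (C ∧ₗ B) X = plug C X ∧ B
  plug (A ∧ᵣ C) X = A ∧ plug C X
  plug (C ∨ₗ B) X = plug C X ∨ B
  plug (A ∨ᵣ C) X = A ∨ plug C X
  plug (πₗ j C B) X = plug C X π[ j ] B
  plug (πᵣ j A C) X = A π[ j ] plug C X

  record Step (A B : Formula) : Set where
    constructor step
    field
      ctx        : Ctx
      premise    : Formula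
      conclusion : Formula
      rule       : Rule premise conclusion
      src        : A ≈P plug ctx premise
      tgt        : plug ctx conclusion ≈P B

  data Derivation : Formula → Formula → Set where
    done : ∀ {A B} → A ≈P B → Derivation A B
    _∷_  : ∀ {A B C} → Step A B → Derivation B C → Derivation A C

module Submission where

-- The unit T splits as T ∧ T (a negated instance of F ∨ F = F)
-- and as T π T (a projection axiom), so the two induction hypotheses can be run in
-- parallel below a conjunction or a projection; a single switch s↓ (for ∧ and, up to
-- commutativity, for ∨) or the rule ai↓ (for π) then regroups the result into A ∨ Ā.

open import Defs
open import Relation.Binary.PropositionalEquality as ≡ using (_≡_)

module _ {V : Set} where

  private
    Fm = Formula V
    infix 4 _≈_
    _≈_ = _≈P_ V
    Deriv = Derivation V
    ⟦_⟧ = plug V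
    ¬_ = neg V

  infixr 5 _∘ᶜ_
  _∘ᶜ_ : Ctx V → Ctx V → Ctx V
  hole       ∘ᶜ K = K
  (C ∧ₗ B)   ∘ᶜ K = (C ∘ᶜ K) ∧ₗ B
  (A ∧ᵣ C)   ∘ᶜ K = A ∧ᵣ (C ∘ᶜ K)
  (C ∨ₗ B)   ∘ᶜ K = (C ∘ᶜ K) ∨ₗ B
  (A ∨ᵣ C)   ∘ᶜ K = A ∨ᵣ (C ∘ᶜ K)
  πₗ j C B   ∘ᶜ K = πₗ j (C ∘ᶜ K) B
  πᵣ j A C   ∘ᶜ K = πᵣ j A (C ∘ᶜ K)

  plug-∘ᶜ : ∀ C K X → ⟦ C ∘ᶜ K ⟧ X ≡ ⟦ C ⟧ (⟦ K ⟧ X)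
  plug-∘ᶜ hole       K X = ≡.refl
  plug-∘ᶜ (C ∧ₗ B)   K X = ≡.cong (_∧ B) (plug-∘ᶜ C K X)
  plug-∘ᶜ (A ∧ᵣ C)   K X = ≡.cong (A ∧_) (plug-∘ᶜ C K X)
  plug-∘ᶜ (C ∨ₗ B)   K X = ≡.cong (_∨ B) (plug-∘ᶜ C K X)
  plug-∘ᶜ (A ∨ᵣ C)   K X = ≡.cong (A ∨_) (plug-∘ᶜ C K X)
  plug-∘ᶜ (πₗ j C B) K X = ≡.cong (_π[ j ] B) (plug-∘ᶜ C K X)
  plug-∘ᶜ (πᵣ j A C) K X = ≡.cong (A π[ j ]_) (plug-∘ᶜ C K X)

  plug-cong : ∀ C {X Y} → X ≈ Y → ⟦ C ⟧ X ≈ ⟦ C ⟧ Y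
  plug-cong hole       e = e
  plug-cong (C ∧ₗ B)   e = ∧-cong (plug-cong C e) refl
  plug-cong (A ∧ᵣ C)   e = ∧-cong refl (plug-cong C e)
  plug-cong (C ∨ₗ B)   e = ∨-cong (plug-cong C e) refl
  plug-cong (A ∨ᵣ C)   e = ∨-cong refl (plug-cong C e)
  plug-cong (πₗ j C B) e = π-cong (plug-cong C e) refl
  plug-cong (πᵣ j A C) e = π-cong refl (plug-cong C e)

  ≈-derivation : ∀ {A B} → A ≈ B → Deriv A B
  ≈-derivation = done

  rule-derivation : ∀ {A B} → Rule V A B → Deriv A B
  rule-derivation r = step hole _ _ r refl refl ∷ done refl

  infixr 5 _++_
  _++_ : ∀ {A B C} → Deriv A B → Deriv B C → Deriv A C
  done e ++ done e′ = done (trans e e′)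
  done e ++ (step C P Q r s t ∷ d) = step C P Q r (trans e s) t ∷ d
  (s ∷ d) ++ d′ = s ∷ (d ++ d′)

  plug-step : ∀ C {A B} → Step V A B → Step V (⟦ C ⟧ A) (⟦ C ⟧ B)
  plug-step C (step K P Q r s t) =
    step (C ∘ᶜ K) P Q r
      (≡.subst (⟦ C ⟧ _ ≈_) (≡.sym (plug-∘ᶜ C K P)) (plug-cong C s))
      (≡.subst (_≈ ⟦ C ⟧ _) (≡.sym (plug-∘ᶜ C K Q)) (plug-cong C t))

  plug-derivation : ∀ C {A B} → Deriv A B → Deriv (⟦ C ⟧ A) (⟦ C ⟧ B)
  plug-derivation C (done e) = done (plug-cong C e)
  plug-derivation C (s ∷ d)  = plug-step C s ∷ plug-derivation C d

  ∧-derivation : ∀ {A A′ B B′} → Deriv A A′ → Deriv B B′ → Deriv (A ∧ B) (A′ ∧ B′)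
  ∧-derivation {A′ = A′} {B = B} d e =
    plug-derivation (hole ∧ₗ B) d ++ plug-derivation (A′ ∧ᵣ hole) e

  π-derivation : ∀ j {A A′ B B′} → Deriv A A′ → Deriv B B′ →
                 Deriv (A π[ j ] B) (A′ π[ j ] B′)
  π-derivation j {A′ = A′} {B = B} d e =
    plug-derivation (πₗ j hole B) d ++ plug-derivation (πᵣ j A′ hole) e

  T≈T∧T : T ≈ T ∧ T
  T≈T∧T = sym (nax F∨F)

  T≈TπT : ∀ j → T ≈ T π[ j ] T
  T≈TπT j0 = sym (ax (π0-proj T T))
  T≈TπT j1 = sym (ax (π1-proj T T))

  ∨-swap : ∀ A B → A ∨ B ≈ B ∨ A
  ∨-swap A B = ax (∨-comm A B)

  T⇒A∨¬A : (A : Fm) → Deriv T (A ∨ ¬ A)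
  T⇒A∨¬A T       = ≈-derivation (sym (ax T∨F))
  T⇒A∨¬A F       = ≈-derivation (sym (ax F∨T))
  T⇒A∨¬A (var x)  = ≈-derivation (sym (ax (x∨x̄ x)))
  T⇒A∨¬A (nvar x) = ≈-derivation (sym (trans (∨-swap _ _) (ax (x∨x̄ x))))
  T⇒A∨¬A (A ∧ B) =
    ≈-derivation T≈T∧T
    ++ ∧-derivation (T⇒A∨¬A A) (T⇒A∨¬A B)
    ++ rule-derivation (s↓ A (¬ A) B (¬ B))
  T⇒A∨¬A (A π[ j ] B) =
    ≈-derivation (T≈TπT j)
    ++ π-derivation j (T⇒A∨¬A A) (T⇒A∨¬A B)
    ++ rule-derivation (ai↓ j A (¬ A) B (¬ B))
  T⇒A∨¬A (A ∨ B) =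
    ≈-derivation T≈T∧T
    ++ ∧-derivation (T⇒A∨¬A A ++ ≈-derivation (∨-swap A (¬ A)))
                    (T⇒A∨¬A B ++ ≈-derivation (∨-swap B (¬ B)))
    ++ rule-derivation (s↓ (¬ A) A (¬ B) B)
    ++ ≈-derivation (∨-swap (¬ A ∧ ¬ B) (A ∨ B))

corollary1 : (V : Set) (A : Formula V) → Derivation V (T) (A ∨ neg V A)
corollary1 V A = T⇒A∨¬A A
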